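{- Let $L$ be a star graph with $\bar{n}$ beams (i.e. $\bar n+1$ vertices: one centre adjacent to $\bar n$ leaves) and let $k$ be a positive integer with $k\leq \frac{\bar{n}-1}{2}$. Then the $k$-particle graph $\mathfrak{L}_k$ of $L$ satisfies $\mathrm{diam}(\mathfrak{L}_k)= 2k$.
   Context: For a finite simple graph $L=(V,E)$ and $k\in\{1,\dots,|V|-1\}$, the $k$-particle graph $\mathfrak{L}_k=(\mathfrak{V}_k,\mathfrak{E}_k)$ of $L$ has vertex set the $k$-element subsets of $V$, two vertices $\mathfrak{v},\mathfrak{w}$ being adjacent iff $\mathfrak{v}\triangle\mathfrak{w}=\{v,w\}$ for some edge $\langle v,w\rangle\in E$. -}

module Defs where

open import Data.Nat using (ℕ; zero; suc; _+_; _≤_)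
open import Data.Fin using (Fin; zero; suc)
open import Data.Fin.Subset using (Subset; _∪_; _─_; ⁅_⁆; ∣_∣)
open import Data.Product using (Σ; ∃; ∃-syntax; _×_; _,_; proj₁)
open import Data.Unit using (⊤)
open import Data.Empty using (⊥)
open import Relation.Binary.PropositionalEquality using (_≡_)

StarAdj : {n̄ : ℕ} → Fin (suc n̄) → Fin (suc n̄) → Set
StarAdj zero    zero    = ⊥
StarAdj zero    (suc _) = ⊤
StarAdj (suc _) zero    = ⊤
StarAdj (suc _) (suc _) = ⊥

_△_ : {n : ℕ} → Subset n → Subset n → Subset n
p △ q = (p ─ q) ∪ (q ─ p)

Config : ℕ → ℕ → Set
Config n k = Σ (Subset n) (λ s → ∣ s ∣ ≡ k)

ParticleAdj : {n : ℕ} (E : Fin n → Fin n → Set) (k : ℕ) → Config n k → Config n k → Set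
ParticleAdj E k a b =
  ∃[ v ] ∃[ w ] (E v w × (proj₁ a △ proj₁ b ≡ ⁅ v ⁆ ∪ ⁅ w ⁆))

data Walk {A : Set} (R : A → A → Set) : A → A → ℕ → Set where
  here : ∀ {x} → Walk R x x zero
  step : ∀ {x y z m} → R x y → Walk R y z m → Walk R x z (suc m)

Dist : {A : Set} (R : A → A → Set) → A → A → ℕ → Set
Dist R x y d = Walk R x y d × (∀ m → Walk R x y m → d ≤ m)

HasDiameter : {A : Set} (R : A → A → Set) → ℕ → Set
HasDiameter {A} R d =
  (∀ (x y : A) → ∃[ m ] (m ≤ d × Dist R x y m))
  × (∃[ x ] ∃[ y ] Dist R x y d)

-- The centre of the star holds a particle exactly when fewer than k leaves
-- do, so a configuration is determined by its set of occupied leaves, and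
-- every move toggles exactly one leaf.  Hence the distance between two
-- configurations is at least the size of the symmetric difference of their
-- leaf sets.  It is also at most that: if the centre is occupied, move its
-- particle to a leaf occupied only in the target; otherwise move a particle
-- from a leaf occupied only in the source into the centre.  A counting
-- argument shows the required leaf exists, and each move shrinks the
-- symmetric difference by one.  Two leaf sets of size k have symmetric
-- difference at most 2k, with equality for disjoint ones, which exist as
-- soon as 2k ≤ n̄.
module Submission where

open import Defs
open import Data.Bool using (not)
open import Data.Empty using (⊥-elim)
open import Data.Fin using (Fin; zero; suc)
open import Data.Fin.Subset
  using (Subset; Side; inside; outside; _∪_; _─_; ⁅_⁆; ∣_∣; ⊥)
open import Data.Fin.Subset.Properties
  using (∪-comm; ∪-identityˡ; ∪-identityʳ; ∣⁅x⁆∣≡1; ∣⊥∣≡0; ∣p∣≤∣x∷p∣; ∣p─q∣≤∣p∣)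
open import Data.Nat using (ℕ; zero; suc; _+_; _*_; _≤_; s≤s; z≤n; s≤s⁻¹)
open import Data.Nat.Properties
open import Data.Product using (Σ-syntax; ∃-syntax; _×_; _,_)
open import Data.Sum using (_⊎_; inj₁; inj₂)
import Data.Sum as Sum
open import Data.Vec using (_∷_; []; tail; _[_]=_; here; there; _[_]%=_)
open import Function using (_∘_; id)
open import Relation.Binary.PropositionalEquality

toggle : ∀ {n} → Fin n → Subset n → Subset n
toggle i p = p [ i ]%= not

p△p≡⊥ : ∀ {n} (p : Subset n) → p △ p ≡ ⊥
p△p≡⊥ []           = refl
p△p≡⊥ (inside ∷ p)  = cong (outside ∷_) (p△p≡⊥ p)
p△p≡⊥ (outside ∷ p) = cong (outside ∷_) (p△p≡⊥ p)

∣p△p∣≡0 : ∀ {n} (p : Subset n) → ∣ p △ p ∣ ≡ 0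
∣p△p∣≡0 {n} p = trans (cong ∣_∣ (p△p≡⊥ p)) (∣⊥∣≡0 n)

∣p△q∣≡0⇒p≡q : ∀ {n} {p q : Subset n} → ∣ p △ q ∣ ≡ 0 → p ≡ q
∣p△q∣≡0⇒p≡q {p = []}          {[]}          _ = refl
∣p△q∣≡0⇒p≡q {p = inside ∷ p}  {inside ∷ q}  e = cong (inside ∷_) (∣p△q∣≡0⇒p≡q e)
∣p△q∣≡0⇒p≡q {p = outside ∷ p} {outside ∷ q} e = cong (outside ∷_) (∣p△q∣≡0⇒p≡q e)

△-comm : ∀ {n} (p q : Subset n) → p △ q ≡ q △ p
△-comm p q = ∪-comm (p ─ q) (q ─ p)

∣x∷p∣≤1+∣p∣ : ∀ {n} x (p : Subset n) → ∣ x ∷ p ∣ ≤ suc ∣ p ∣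
∣x∷p∣≤1+∣p∣ inside  p = ≤-refl
∣x∷p∣≤1+∣p∣ outside p = n≤1+n ∣ p ∣

∣p∪q∣≤∣p∣+∣q∣ : ∀ {n} (p q : Subset n) → ∣ p ∪ q ∣ ≤ ∣ p ∣ + ∣ q ∣
∣p∪q∣≤∣p∣+∣q∣ []            []            = z≤n
∣p∪q∣≤∣p∣+∣q∣ (inside ∷ p)  (inside ∷ q)  =
  s≤s (≤-trans (∣p∪q∣≤∣p∣+∣q∣ p q) (≤-trans (n≤1+n _) (≤-reflexive (sym (+-suc ∣ p ∣ ∣ q ∣)))))
∣p∪q∣≤∣p∣+∣q∣ (inside ∷ p)  (outside ∷ q) = s≤s (∣p∪q∣≤∣p∣+∣q∣ p q)
∣p∪q∣≤∣p∣+∣q∣ (outside ∷ p) (inside ∷ q)  =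
  ≤-trans (s≤s (∣p∪q∣≤∣p∣+∣q∣ p q)) (≤-reflexive (sym (+-suc ∣ p ∣ ∣ q ∣)))
∣p∪q∣≤∣p∣+∣q∣ (outside ∷ p) (outside ∷ q) = ∣p∪q∣≤∣p∣+∣q∣ p q

∣p△q∣≤∣p∣+∣q∣ : ∀ {n} (p q : Subset n) → ∣ p △ q ∣ ≤ ∣ p ∣ + ∣ q ∣
∣p△q∣≤∣p∣+∣q∣ p q =
  ≤-trans (∣p∪q∣≤∣p∣+∣q∣ (p ─ q) (q ─ p)) (+-mono-≤ (∣p─q∣≤∣p∣ p q) (∣p─q∣≤∣p∣ q p))

∣p△r∣≤∣p△q∣+∣q△r∣ : ∀ {n} (p q r : Subset n) → ∣ p △ r ∣ ≤ ∣ p △ q ∣ + ∣ q △ r ∣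
∣p△r∣≤∣p△q∣+∣q△r∣ [] [] [] = z≤n
∣p△r∣≤∣p△q∣+∣q△r∣ (x ∷ p) (y ∷ q) (z ∷ r) = cases x y z
  where
  a = ∣ p △ q ∣
  b = ∣ q △ r ∣
  ih : ∣ p △ r ∣ ≤ a + b
  ih = ∣p△r∣≤∣p△q∣+∣q△r∣ p q r
  ih+left : suc ∣ p △ r ∣ ≤ a + suc b
  ih+left = ≤-trans (s≤s ih) (≤-reflexive (sym (+-suc a b)))
  ih+both : ∣ p △ r ∣ ≤ suc (a + suc b)
  ih+both = ≤-trans ih (≤-trans (+-monoʳ-≤ a (n≤1+n b)) (n≤1+n _))
  cases : ∀ x y z → ∣ (x ∷ p) △ (z ∷ r) ∣ ≤ ∣ (x ∷ p) △ (y ∷ q) ∣ + ∣ (y ∷ q) △ (z ∷ r) ∣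
  cases inside  inside  inside  = ih
  cases inside  inside  outside = ih+left
  cases inside  outside inside  = ih+both
  cases inside  outside outside = s≤s ih
  cases outside inside  inside  = s≤s ih
  cases outside inside  outside = ih+both
  cases outside outside inside  = ih+left
  cases outside outside outside = ih

p△toggle≡⁅i⁆ : ∀ {n} (i : Fin n) (p : Subset n) → p △ toggle i p ≡ ⁅ i ⁆
p△toggle≡⁅i⁆ zero    (inside ∷ p)  = cong (inside ∷_) (p△p≡⊥ p)
p△toggle≡⁅i⁆ zero    (outside ∷ p) = cong (inside ∷_) (p△p≡⊥ p)
p△toggle≡⁅i⁆ (suc i) (inside ∷ p)  = cong (outside ∷_) (p△toggle≡⁅i⁆ i p)
p△toggle≡⁅i⁆ (suc i) (outside ∷ p) = cong (outside ∷_) (p△toggle≡⁅i⁆ i p)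

∣toggle-outside∣ : ∀ {n} {i : Fin n} {p : Subset n} →
  p [ i ]= outside → ∣ toggle i p ∣ ≡ suc ∣ p ∣
∣toggle-outside∣ here = refl
∣toggle-outside∣ {p = inside ∷ _}  (there p[i]) = cong suc (∣toggle-outside∣ p[i])
∣toggle-outside∣ {p = outside ∷ _} (there p[i]) = ∣toggle-outside∣ p[i]

∣toggle-inside∣ : ∀ {n} {i : Fin n} {p : Subset n} →
  p [ i ]= inside → suc ∣ toggle i p ∣ ≡ ∣ p ∣
∣toggle-inside∣ here = refl
∣toggle-inside∣ {p = inside ∷ _}  (there p[i]) = cong suc (∣toggle-inside∣ p[i])
∣toggle-inside∣ {p = outside ∷ _} (there p[i]) = ∣toggle-inside∣ p[i]

∣toggle△∣ : ∀ {n} {i : Fin n} {x : Side} {p q : Subset n} →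
  p [ i ]= x → q [ i ]= not x → suc ∣ toggle i p △ q ∣ ≡ ∣ p △ q ∣
∣toggle△∣ {x = inside}  here here = refl
∣toggle△∣ {x = outside} here here = refl
∣toggle△∣ {p = inside ∷ _}  {inside ∷ _}  (there p[i]) (there q[i]) = ∣toggle△∣ p[i] q[i]
∣toggle△∣ {p = inside ∷ _}  {outside ∷ _} (there p[i]) (there q[i]) = cong suc (∣toggle△∣ p[i] q[i])
∣toggle△∣ {p = outside ∷ _} {inside ∷ _}  (there p[i]) (there q[i]) = cong suc (∣toggle△∣ p[i] q[i])
∣toggle△∣ {p = outside ∷ _} {outside ∷ _} (there p[i]) (there q[i]) = ∣toggle△∣ p[i] q[i]

OutsideInside : ∀ {n} → Subset n → Subset n → Set
OutsideInside p q = ∃[ i ] p [ i ]= outside × q [ i ]= inside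

outsideInside-∷ : ∀ {n x y} {p q : Subset n} → OutsideInside p q → OutsideInside (x ∷ p) (y ∷ q)
outsideInside-∷ (i , p[i] , q[i]) = suc i , there p[i] , there q[i]

-- The right disjunct is what q ⊆ p amounts to for cardinalities.
outsideInside⊎∣p△q∣+∣q∣≡∣p∣ : ∀ {n} (p q : Subset n) →
  OutsideInside p q ⊎ ∣ p △ q ∣ + ∣ q ∣ ≡ ∣ p ∣
outsideInside⊎∣p△q∣+∣q∣≡∣p∣ [] [] = inj₂ refl
outsideInside⊎∣p△q∣+∣q∣≡∣p∣ (outside ∷ p) (inside ∷ q) = inj₁ (zero , here , here)
outsideInside⊎∣p△q∣+∣q∣≡∣p∣ (inside ∷ p) (inside ∷ q) =
  Sum.map outsideInside-∷ (λ e → trans (+-suc ∣ p △ q ∣ ∣ q ∣) (cong suc e))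
    (outsideInside⊎∣p△q∣+∣q∣≡∣p∣ p q)
outsideInside⊎∣p△q∣+∣q∣≡∣p∣ (inside ∷ p) (outside ∷ q) =
  Sum.map outsideInside-∷ (cong suc) (outsideInside⊎∣p△q∣+∣q∣≡∣p∣ p q)
outsideInside⊎∣p△q∣+∣q∣≡∣p∣ (outside ∷ p) (outside ∷ q) =
  Sum.map outsideInside-∷ id (outsideInside⊎∣p△q∣+∣q∣≡∣p∣ p q)

∣p∣≤∣q∣⇒outsideInside : ∀ {n m} {p q : Subset n} →
  ∣ p ∣ ≤ ∣ q ∣ → ∣ p △ q ∣ ≡ suc m → OutsideInside p q
∣p∣≤∣q∣⇒outsideInside {m = m} {p} {q} ∣p∣≤∣q∣ ∣p△q∣≡1+m
  with outsideInside⊎∣p△q∣+∣q∣≡∣p∣ p q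
... | inj₁ w = w
... | inj₂ e = ⊥-elim (m+n≮n m ∣ q ∣
  (≤-trans (≤-reflexive (trans (sym (cong (_+ ∣ q ∣) ∣p△q∣≡1+m)) e)) ∣p∣≤∣q∣))

far-apart-subsets : ∀ {n} k → k * 2 ≤ n →
  Σ[ p ∈ Subset n ] Σ[ q ∈ Subset n ] (∣ p ∣ ≡ k × ∣ q ∣ ≡ k × ∣ p △ q ∣ ≡ k * 2)
far-apart-subsets {n} zero _ = ⊥ , ⊥ , ∣⊥∣≡0 n , ∣⊥∣≡0 n , ∣p△p∣≡0 (⊥ {n})
far-apart-subsets (suc k) (s≤s (s≤s k*2≤n)) with far-apart-subsets k k*2≤n
... | p , q , ∣p∣≡k , ∣q∣≡k , ∣p△q∣≡k*2 =
  inside ∷ outside ∷ p , outside ∷ inside ∷ q ,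
  cong suc ∣p∣≡k , cong suc ∣q∣≡k , cong (2 +_) ∣p△q∣≡k*2

module _ {n k : ℕ} where

  private
    _~_ : Config (suc n) k → Config (suc n) k → Set
    _~_ = ParticleAdj (StarAdj {n}) k

  leaves : Config (suc n) k → Subset n
  leaves (s , _) = tail s

  leafDistance : Config (suc n) k → Config (suc n) k → ℕ
  leafDistance a b = ∣ leaves a △ leaves b ∣

  ∣leaves∣≤k : ∀ a → ∣ leaves a ∣ ≤ k
  ∣leaves∣≤k (x ∷ p , ∣x∷p∣≡k) = ≤-trans (∣p∣≤∣x∷p∣ x p) (≤-reflexive ∣x∷p∣≡k)

  leafDistance≤2k : ∀ a b → leafDistance a b ≤ 2 * k
  leafDistance≤2k a b = ≤-trans (∣p△q∣≤∣p∣+∣q∣ (leaves a) (leaves b))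
    (+-mono-≤ (∣leaves∣≤k a) (≤-trans (∣leaves∣≤k b) (≤-reflexive (sym (+-identityʳ k)))))

  leaves-injective : ∀ {a b} → leaves a ≡ leaves b → a ≡ b
  leaves-injective {inside ∷ p , e} {inside ∷ .p , e'} refl =
    cong (inside ∷ p ,_) (≡-irrelevant e e')
  leaves-injective {outside ∷ p , e} {outside ∷ .p , e'} refl =
    cong (outside ∷ p ,_) (≡-irrelevant e e')
  leaves-injective {inside ∷ p , e} {outside ∷ .p , e'} refl = ⊥-elim (1+n≢n (trans e (sym e')))
  leaves-injective {outside ∷ p , e} {inside ∷ .p , e'} refl = ⊥-elim (1+n≢n (trans e' (sym e)))

  adjacent⇒leafDistance≡1 : ∀ {a b} → a ~ b → leafDistance a b ≡ 1
  adjacent⇒leafDistance≡1 {_ ∷ p , _} {_ ∷ q , _} (zero , suc i , _ , e) =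
    trans (cong (∣_∣ ∘ tail) e) (trans (cong ∣_∣ (∪-identityˡ ⁅ i ⁆)) (∣⁅x⁆∣≡1 i))
  adjacent⇒leafDistance≡1 {_ ∷ p , _} {_ ∷ q , _} (suc i , zero , _ , e) =
    trans (cong (∣_∣ ∘ tail) e) (trans (cong ∣_∣ (∪-identityʳ ⁅ i ⁆)) (∣⁅x⁆∣≡1 i))

  leafDistance≤length : ∀ {a b m} → Walk _~_ a b m → leafDistance a b ≤ m
  leafDistance≤length {a} here = ≤-reflexive (∣p△p∣≡0 (leaves a))
  leafDistance≤length {a} {b} (step {y = c} a~c w) =
    ≤-trans (∣p△r∣≤∣p△q∣+∣q△r∣ (leaves a) (leaves c) (leaves b))
      (+-mono-≤ (≤-reflexive (adjacent⇒leafDistance≡1 {a} {c} a~c)) (leafDistance≤length w))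

  centre⇄leaf : ∀ x p (i : Fin n) e e' → (x ∷ p , e) ~ (not x ∷ toggle i p , e')
  centre⇄leaf inside  p i _ _ = zero , suc i , _ ,
    cong (inside ∷_) (trans (p△toggle≡⁅i⁆ i p) (sym (∪-identityˡ ⁅ i ⁆)))
  centre⇄leaf outside p i _ _ = zero , suc i , _ ,
    cong (inside ∷_) (trans (p△toggle≡⁅i⁆ i p) (sym (∪-identityˡ ⁅ i ⁆)))

  closer-neighbour : ∀ {a b m} → leafDistance a b ≡ suc m →
    ∃[ c ] a ~ c × leafDistance c b ≡ m
  closer-neighbour {inside ∷ p , e} {y ∷ q , e'} d
    with ∣p∣≤∣q∣⇒outsideInside {p = p} {q} (s≤s⁻¹ (≤-trans (≤-reflexive (trans e (sym e'))) (∣x∷p∣≤1+∣p∣ y q))) d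
  ... | i , p[i] , q[i] =
    (outside ∷ toggle i p , e″) , centre⇄leaf inside p i e e″ ,
    suc-injective (trans (∣toggle△∣ {p = p} {q} p[i] q[i]) d)
    where e″ = trans (∣toggle-outside∣ p[i]) e
  closer-neighbour {outside ∷ p , e} {y ∷ q , e'} d
    with ∣p∣≤∣q∣⇒outsideInside {p = q} {p} (≤-trans (∣p∣≤∣x∷p∣ y q) (≤-reflexive (trans e' (sym e))))
           (trans (cong ∣_∣ (△-comm q p)) d)
  ... | i , q[i] , p[i] =
    (inside ∷ toggle i p , e″) , centre⇄leaf outside p i e e″ ,
    suc-injective (trans (∣toggle△∣ {p = p} {q} p[i] q[i]) d)
    where e″ = trans (∣toggle-inside∣ p[i]) e

  walk-of-leafDistance : ∀ m {a b} → leafDistance a b ≡ m → Walk _~_ a b m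
  walk-of-leafDistance zero {a} {b} d with leaves-injective {a} {b} (∣p△q∣≡0⇒p≡q d)
  ... | refl = here
  walk-of-leafDistance (suc m) {a} {b} d with closer-neighbour {a} {b} d
  ... | c , a~c , d' = step a~c (walk-of-leafDistance m {c} {b} d')

  dist≡leafDistance : ∀ a b → Dist _~_ a b (leafDistance a b)
  dist≡leafDistance a b = walk-of-leafDistance _ {a} {b} refl , λ _ → leafDistance≤length

corollary3p8 : (n̄ k : ℕ) → 1 ≤ k → 2 * k + 1 ≤ n̄ →
    HasDiameter (ParticleAdj (StarAdj {n̄}) k) (2 * k)
corollary3p8 n̄ k _ 2k+1≤n̄
  with far-apart-subsets k (≤-trans (≤-reflexive (*-comm k 2)) (m+n≤o⇒m≤o (2 * k) 2k+1≤n̄))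
... | p , q , ∣p∣≡k , ∣q∣≡k , ∣p△q∣≡k*2 =
  (λ a b → leafDistance a b , leafDistance≤2k a b , dist≡leafDistance a b) ,
  x , y , subst (Dist _ x y) (trans ∣p△q∣≡k*2 (*-comm k 2)) (dist≡leafDistance x y)
  where
  x y : Config (suc n̄) k
  x = outside ∷ p , ∣p∣≡k
  y = outside ∷ q , ∣q∣≡k
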